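{- If $G$ is a graph with $n$ vertices that is a disjoint union of complete graphs, then $[n-1]\subseteq\Upsilon(G)$.
   Context: All graphs are finite and simple. For a positive integer $p$ and a digraph $D=(V,A)$ with $A\subseteq V\times V$ (loops allowed), the $p$-competition graph $C_p(D)$ has vertex set $V$, and distinct $x,y$ are adjacent iff there are $p$ distinct vertices $a_1,\dots,a_p\in V$ with $(x,a_i),(y,a_i)\in A$ for all $i$. A graph is a $p$-competition graph if it equals $C_p(D)$ for some digraph $D$. For a graph $G$ with $n$ vertices, $[n]=\{1,\dots,n\}$ and $\Upsilon(G)=\{p\in[n]\mid G\text{ is a }p\text{ -competition graph}\}$. -}

module Defs where

open import Level using (0ℓ)
open import Data.Nat using (ℕ; _≤_; _∸_)
open import Data.Fin using (Fin)
open import Data.Product using (Σ; _×_; ∃)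
open import Relation.Binary.PropositionalEquality using (_≡_; _≢_)
open import Relation.Nullary using (¬_)
open import Function.Definitions using (Injective)
open import Function.Bundles using (_⇔_)

record Graph (n : ℕ) : Set₁ where
  field
    Adj   : Fin n → Fin n → Set
    sym   : ∀ {x y} → Adj x y → Adj y x
    irref : ∀ {x} → ¬ Adj x x
open Graph public

Digraph : ℕ → Set₁
Digraph n = Fin n → Fin n → Set

CommonPrey : ∀ {n} → ℕ → Digraph n → Fin n → Fin n → Set
CommonPrey {n} p D x y =
  Σ (Fin p → Fin n) λ a → Injective _≡_ _≡_ a × (∀ i → D x (a i) × D y (a i))

-- G equals the p-competition graph C_p(D) (both on vertex set Fin n;
-- the diagonal agrees automatically since both graphs are loopless).
IsCompetitionGraphOf : ∀ {n} → ℕ → Graph n → Digraph n → Set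
IsCompetitionGraphOf p G D =
  ∀ x y → x ≢ y → (Adj G x y ⇔ CommonPrey p D x y)

IsPCompetitionGraph : ∀ {n} → ℕ → Graph n → Set₁
IsPCompetitionGraph {n} p G = Σ (Digraph n) λ D → IsCompetitionGraphOf p G D

InUpsilon : ∀ {n} → Graph n → ℕ → Set₁
InUpsilon {n} G p = (1 ≤ p × p ≤ n) × IsPCompetitionGraph p G

IsDisjointUnionOfCompleteGraphs : ∀ {n} → Graph n → Set
IsDisjointUnionOfCompleteGraphs {n} G =
  Σ (Fin n → ℕ) λ c → ∀ x y → x ≢ y → (Adj G x y ⇔ (c x ≡ c y))

-- Give every clique its own start r ∈ ℤ/n and let each of its vertices prey on the cyclic
-- window W_r = {r, r + 1, …, r + p − 1}; vertices of one clique then share p prey. Since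
-- p < n, distinct windows W_i and W_j differ: if j ∈ W_i then j − 1 ∈ W_i ∖ W_j, and
-- otherwise j ∈ W_j ∖ W_i. An element of W_i outside W_j, added to p common prey of W_i
-- and W_j, would give p + 1 distinct elements of W_i, which has only p.
module Submission where

open import Defs
open import Data.Nat using (ℕ; _≤_; _∸_)
open import Data.Product using (_×_)

import Data.Nat as ℕ
open import Data.Nat using (pred; _+_; _<_; s≤s; NonZero; ≢-nonZero)
open import Data.Nat.Properties
  using (<-≤-trans; <⇒≤; m≤n⇒m≤1+n; m∸n+n≡m; m+[n∸m]≡n; +-assoc; +-suc; suc-pred;
         pred[n]≤n; n<1+n; ≤-reflexive; ≤-<-trans; 1+n≰n; <⇒≤pred; <⇒≱)
  renaming (_<?_ to _<ℕ?_; _≟_ to _≟ℕ_)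
open import Data.Nat.DivMod using (_%_; m%n<n; m%n%n≡m%n; %-distribˡ-+; n%n≡0; [m+n]%n≡m%n; m<n⇒m%n≡m)
open import Data.Nat.Tactic.RingSolver using (solve-∀)
open import Data.Fin using (Fin; zero; suc; toℕ; fromℕ<; _≟_)
open import Data.Fin.Properties using (toℕ-injective; toℕ<n; toℕ-fromℕ<; fromℕ<-injective; any?; injective⇒≤)
open import Data.Vec.Functional using (_∷_)
open import Data.Product using (Σ; ∃; _,_; proj₁; proj₂; swap)
open import Data.Sum using (_⊎_; inj₁; inj₂)
open import Data.Empty using (⊥-elim)
open import Relation.Nullary using (¬_; yes; no)
open import Relation.Binary.PropositionalEquality as ≡ using (_≡_; _≢_; refl; cong; subst; module ≡-Reasoning)
open import Function.Base using (_∘_)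
open import Function.Definitions using (Injective)
open import Function.Bundles using (_⇔_; mk⇔)
open import Function.Construct.Composition using (_⇔-∘_)

open ≡-Reasoning

[m+n]+[o+p]≡[o+n]+[m+p] : ∀ m n o p → m + n + (o + p) ≡ o + n + (m + p)
[m+n]+[o+p]≡[o+n]+[m+p] = solve-∀

[m%n+o]%n≡[m+o]%n : ∀ m o n .{{_ : NonZero n}} → (m % n + o) % n ≡ (m + o) % n
[m%n+o]%n≡[m+o]%n m o n = begin
  (m % n + o) % n          ≡⟨ %-distribˡ-+ (m % n) o n ⟩
  (m % n % n + o % n) % n  ≡⟨ cong (λ v → (v + o % n) % n) (m%n%n≡m%n m n) ⟩
  (m % n + o % n) % n      ≡⟨ %-distribˡ-+ m o n ⟨
  (m + o) % n              ∎

module CyclicWindow {N : ℕ} .{{_ : NonZero N}} where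

  -- (e − r) mod N, with N ∸ r in place of − r so that no subtraction truncates.
  offset : Fin N → Fin N → ℕ
  offset r e = (toℕ e + (N ∸ toℕ r)) % N

  atOffset : Fin N → ℕ → Fin N
  atOffset r k = fromℕ< (m%n<n (k + toℕ r) N)

  pred[N]<N : pred N < N
  pred[N]<N = <-≤-trans (n<1+n (pred N)) (≤-reflexive (suc-pred N))

  offset<N : ∀ r e → offset r e < N
  offset<N r e = m%n<n (toℕ e + (N ∸ toℕ r)) N

  offset-self : ∀ r → offset r r ≡ 0
  offset-self r = begin
    (toℕ r + (N ∸ toℕ r)) % N  ≡⟨ cong (_% N) (m+[n∸m]≡n (<⇒≤ (toℕ<n r))) ⟩
    N % N                      ≡⟨ n%n≡0 N ⟩
    0                          ∎

  offset-cocycle : ∀ i j e → offset i e ≡ (offset i j + offset j e) % N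
  offset-cocycle i j e = ≡.sym (begin
    ((toℕ j + (N ∸ toℕ i)) % N + (toℕ e + (N ∸ toℕ j)) % N) % N
      ≡⟨ %-distribˡ-+ (toℕ j + (N ∸ toℕ i)) (toℕ e + (N ∸ toℕ j)) N ⟨
    (toℕ j + (N ∸ toℕ i) + (toℕ e + (N ∸ toℕ j))) % N
      ≡⟨ cong (_% N) ([m+n]+[o+p]≡[o+n]+[m+p] (toℕ j) (N ∸ toℕ i) (toℕ e) (N ∸ toℕ j)) ⟩
    (toℕ e + (N ∸ toℕ i) + (toℕ j + (N ∸ toℕ j))) % N
      ≡⟨ cong (λ v → (toℕ e + (N ∸ toℕ i) + v) % N) (m+[n∸m]≡n (<⇒≤ (toℕ<n j))) ⟩
    (toℕ e + (N ∸ toℕ i) + N) % N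
      ≡⟨ [m+n]%n≡m%n (toℕ e + (N ∸ toℕ i)) N ⟩
    (toℕ e + (N ∸ toℕ i)) % N ∎)

  offset-retraction : ∀ r e → (offset r e + toℕ r) % N ≡ toℕ e
  offset-retraction r e = begin
    ((toℕ e + (N ∸ toℕ r)) % N + toℕ r) % N  ≡⟨ [m%n+o]%n≡[m+o]%n (toℕ e + (N ∸ toℕ r)) (toℕ r) N ⟩
    (toℕ e + (N ∸ toℕ r) + toℕ r) % N        ≡⟨ cong (_% N) (+-assoc (toℕ e) (N ∸ toℕ r) (toℕ r)) ⟩
    (toℕ e + ((N ∸ toℕ r) + toℕ r)) % N      ≡⟨ cong (λ v → (toℕ e + v) % N) (m∸n+n≡m (<⇒≤ (toℕ<n r))) ⟩
    (toℕ e + N) % N                          ≡⟨ [m+n]%n≡m%n (toℕ e) N ⟩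
    toℕ e % N                                ≡⟨ m<n⇒m%n≡m (toℕ<n e) ⟩
    toℕ e                                    ∎

  offset-injective : ∀ r → Injective _≡_ _≡_ (offset r)
  offset-injective r {e} {e′} eq = toℕ-injective (begin
    toℕ e                      ≡⟨ offset-retraction r e ⟨
    (offset r e + toℕ r) % N   ≡⟨ cong (λ o → (o + toℕ r) % N) eq ⟩
    (offset r e′ + toℕ r) % N  ≡⟨ offset-retraction r e′ ⟩
    toℕ e′                     ∎)

  offset-atOffset : ∀ r {k} → k < N → offset r (atOffset r k) ≡ k
  offset-atOffset r {k} k<N = begin
    (toℕ (atOffset r k) + (N ∸ toℕ r)) % N  ≡⟨ cong (λ v → (v + (N ∸ toℕ r)) % N) (toℕ-fromℕ< _) ⟩
    ((k + toℕ r) % N + (N ∸ toℕ r)) % N     ≡⟨ [m%n+o]%n≡[m+o]%n (k + toℕ r) (N ∸ toℕ r) N ⟩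
    (k + toℕ r + (N ∸ toℕ r)) % N           ≡⟨ cong (_% N) (+-assoc k (toℕ r) (N ∸ toℕ r)) ⟩
    (k + (toℕ r + (N ∸ toℕ r))) % N         ≡⟨ cong (λ v → (k + v) % N) (m+[n∸m]≡n (<⇒≤ (toℕ<n r))) ⟩
    (k + N) % N                             ≡⟨ [m+n]%n≡m%n k N ⟩
    k % N                                   ≡⟨ m<n⇒m%n≡m k<N ⟩
    k                                       ∎

  offset-≢0 : ∀ {i j} → i ≢ j → offset i j ≢ 0
  offset-≢0 {i} {j} i≢j o≡0 = i≢j (offset-injective i (≡.trans (offset-self i) (≡.sym o≡0)))

  offset-predecessor : ∀ {i j} → i ≢ j → offset i (atOffset j (pred N)) ≡ pred (offset i j)
  offset-predecessor {i} {j} i≢j = begin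
    offset i d                 ≡⟨ offset-cocycle i j d ⟩
    (o + offset j d) % N       ≡⟨ cong (λ v → (o + v) % N) (offset-atOffset j pred[N]<N) ⟩
    (o + pred N) % N           ≡⟨ cong (_% N) o+pred[N]≡pred[o]+N ⟩
    (pred o + N) % N           ≡⟨ [m+n]%n≡m%n (pred o) N ⟩
    pred o % N                 ≡⟨ m<n⇒m%n≡m (≤-<-trans pred[n]≤n (offset<N i j)) ⟩
    pred o                     ∎
    where
    d = atOffset j (pred N)
    o = offset i j
    o+pred[N]≡pred[o]+N : o + pred N ≡ pred o + N
    o+pred[N]≡pred[o]+N = begin
      o + pred N               ≡⟨ cong (_+ pred N) (suc-pred o {{≢-nonZero (offset-≢0 i≢j)}}) ⟨
      ℕ.suc (pred o) + pred N  ≡⟨ +-suc (pred o) (pred N) ⟨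
      pred o + ℕ.suc (pred N)  ≡⟨ cong (pred o +_) (suc-pred N) ⟩
      pred o + N               ∎

  InWindow : ℕ → Fin N → Fin N → Set
  InWindow p r e = offset r e < p

  window-enumeration : ∀ {p} → p ≤ N → ∀ r →
    Σ (Fin p → Fin N) λ a → Injective _≡_ _≡_ a × (∀ k → InWindow p r (a k))
  window-enumeration {p} p≤N r = a , a-injective , a∈W
    where
    a : Fin p → Fin N
    a k = atOffset r (toℕ k)
    offset-a : ∀ k → offset r (a k) ≡ toℕ k
    offset-a k = offset-atOffset r (<-≤-trans (toℕ<n k) p≤N)
    a-injective : Injective _≡_ _≡_ a
    a-injective {k} {k′} eq =
      toℕ-injective (≡.trans (≡.sym (offset-a k)) (≡.trans (cong (offset r) eq) (offset-a k′)))
    a∈W : ∀ k → InWindow p r (a k)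
    a∈W k = subst (_< p) (≡.sym (offset-a k)) (toℕ<n k)

  window-injection⇒≤ : ∀ {p q} r (b : Fin q → Fin N) → Injective _≡_ _≡_ b →
    (∀ k → InWindow p r (b k)) → q ≤ p
  window-injection⇒≤ r b b-injective b∈W = injective⇒≤ {f = λ k → fromℕ< (b∈W k)}
    (λ {k} {k′} eq → b-injective (offset-injective r (fromℕ<-injective _ _ (b∈W k) (b∈W k′) eq)))

  distinct-windows-differ : ∀ {p i j} → 1 ≤ p → p < N → i ≢ j →
    (∃ λ d → InWindow p i d × ¬ InWindow p j d) ⊎ (∃ λ d → InWindow p j d × ¬ InWindow p i d)
  distinct-windows-differ {p} {i} {j} 1≤p p<N i≢j with offset i j <ℕ? p
  ... | no j∉Wᵢ = inj₂ (j , subst (_< p) (≡.sym (offset-self j)) 1≤p , j∉Wᵢ)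
  ... | yes j∈Wᵢ = inj₁ (atOffset j (pred N) , d∈Wᵢ , d∉Wⱼ)
    where
    d∈Wᵢ : InWindow p i (atOffset j (pred N))
    d∈Wᵢ = subst (_< p) (≡.sym (offset-predecessor i≢j)) (≤-<-trans pred[n]≤n j∈Wᵢ)
    d∉Wⱼ : ¬ InWindow p j (atOffset j (pred N))
    d∉Wⱼ d∈Wⱼ = <⇒≱ (subst (_< p) (offset-atOffset j pred[N]<N) d∈Wⱼ) (<⇒≤pred p<N)

  escaping-element⇒¬p-common : ∀ {p} i j d → InWindow p i d → ¬ InWindow p j d →
    (a : Fin p → Fin N) → Injective _≡_ _≡_ a → ¬ (∀ k → InWindow p i (a k) × InWindow p j (a k))
  escaping-element⇒¬p-common {p} i j d d∈Wᵢ d∉Wⱼ a a-injective a∈W =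
    1+n≰n (window-injection⇒≤ i (d ∷ a) d∷a-injective d∷a∈Wᵢ)
    where
    d≢a : ∀ k → d ≢ a k
    d≢a k d≡ak = d∉Wⱼ (subst (InWindow p j) (≡.sym d≡ak) (proj₂ (a∈W k)))
    d∷a-injective : Injective _≡_ _≡_ (d ∷ a)
    d∷a-injective {zero}  {zero}   _  = refl
    d∷a-injective {zero}  {suc k}  eq = ⊥-elim (d≢a k eq)
    d∷a-injective {suc k} {zero}   eq = ⊥-elim (d≢a k (≡.sym eq))
    d∷a-injective {suc k} {suc k′} eq = cong suc (a-injective eq)
    d∷a∈Wᵢ : ∀ k → InWindow p i ((d ∷ a) k)
    d∷a∈Wᵢ zero    = d∈Wᵢ
    d∷a∈Wᵢ (suc k) = proj₁ (a∈W k)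

  windowDigraph : ℕ → (Fin N → Fin N) → Digraph N
  windowDigraph p start x = InWindow p (start x)

  sameStart⇔commonPrey : ∀ {p} → 1 ≤ p → p < N → ∀ start x y →
    start x ≡ start y ⇔ CommonPrey p (windowDigraph p start) x y
  sameStart⇔commonPrey {p} 1≤p p<N start x y = mk⇔ commonPrey sameStart
    where
    sameStart : CommonPrey p (windowDigraph p start) x y → start x ≡ start y
    sameStart (a , a-injective , a∈W) with start x ≟ start y
    ... | yes eq = eq
    ... | no ≢ with distinct-windows-differ 1≤p p<N ≢
    ...   | inj₁ (d , d∈Wₓ , d∉Wᵧ) =
      ⊥-elim (escaping-element⇒¬p-common (start x) (start y) d d∈Wₓ d∉Wᵧ a a-injective a∈W)
    ...   | inj₂ (d , d∈Wᵧ , d∉Wₓ) =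
      ⊥-elim (escaping-element⇒¬p-common (start y) (start x) d d∈Wᵧ d∉Wₓ a a-injective (swap ∘ a∈W))
    commonPrey : start x ≡ start y → CommonPrey p (windowDigraph p start) x y
    commonPrey eq with a , a-injective , a∈W ← window-enumeration (<⇒≤ p<N) (start x) =
      a , a-injective , λ k → a∈W k , subst (λ r → InWindow p r (a k)) eq (a∈W k)

module Representative {N : ℕ} (label : Fin N → ℕ) where

  private
    pick : ∀ k → ∃ (λ y → label y ≡ k) → Fin N
    pick k w with any? (λ y → label y ≟ℕ k)
    ... | yes (y , _) = y
    ... | no ∄ = ⊥-elim (∄ w)

    pick-labelled : ∀ k w → label (pick k w) ≡ k
    pick-labelled k w with any? (λ y → label y ≟ℕ k)
    ... | yes (_ , labelled) = labelled
    ... | no ∄ = ⊥-elim (∄ w)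

    pick-cong : ∀ {k k′} w w′ → k ≡ k′ → pick k w ≡ pick k′ w′
    pick-cong {k} w w′ refl with any? (λ y → label y ≟ℕ k)
    ... | yes _ = refl
    ... | no ∄ = ⊥-elim (∄ w)

  rep : Fin N → Fin N
  rep x = pick (label x) (x , refl)

  sameLabel⇔sameRep : ∀ x y → label x ≡ label y ⇔ rep x ≡ rep y
  sameLabel⇔sameRep x y = mk⇔ (pick-cong (x , refl) (y , refl)) sameLabel
    where
    sameLabel : rep x ≡ rep y → label x ≡ label y
    sameLabel eq = begin
      label x        ≡⟨ pick-labelled (label x) (x , refl) ⟨
      label (rep x)  ≡⟨ cong label eq ⟩
      label (rep y)  ≡⟨ pick-labelled (label y) (y , refl) ⟩
      label y        ∎

mainTheorem18 : (n : ℕ) (G : Graph n) → IsDisjointUnionOfCompleteGraphs G →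
    (p : ℕ) → 1 ≤ p → p ≤ n ∸ 1 → InUpsilon G p
mainTheorem18 ℕ.zero G _ p 1≤p p≤0 = ⊥-elim (<⇒≱ 1≤p p≤0)
mainTheorem18 (ℕ.suc m) G (label , adj⇔sameLabel) p 1≤p p≤m =
  (1≤p , m≤n⇒m≤1+n p≤m) , windowDigraph p rep , λ x y x≢y →
    sameStart⇔commonPrey 1≤p (s≤s p≤m) rep x y
      ⇔-∘ (sameLabel⇔sameRep x y ⇔-∘ adj⇔sameLabel x y x≢y)
  where
  open CyclicWindow {ℕ.suc m}
  open Representative label
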